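{- Let $\Omega$ be a finite set of odd size $n\ge3$. Then: (1) For every $\omega\in\Omega$, the hypergraph $\mathcal{H}_\omega=\{\{\omega\}\}\cup\mathcal{U}_{2,\Omega\setminus\{\omega\}}$ is a domination hypergraph; moreover, for a graph $G$ with vertex set $\Omega$, $\mathcal{D}(G)=\mathcal{H}_\omega$ if and only if $G=K_{\{\omega\}}\vee G'$ where $G'$ is a graph with vertex set $\Omega\setminus\{\omega\}$ and $\mathcal{D}(G')=\mathcal{U}_{2,\Omega\setminus\{\omega\}}$. (2) $\mathcal{U}_{2,\Omega}$ has exactly $n$ minimal domination completions; namely, if $\Omega=\{\omega_1,\dots,\omega_n\}$, the set of minimal domination completions is $\{\mathcal{H}_{\omega_1},\dots,\mathcal{H}_{\omega_n}\}$. (3) For any two distinct $\omega_{i_1},\omega_{i_2}\in\Omega$, $\mathcal{U}_{2,\Omega}=\mathcal{H}_{\omega_{i_1}}\sqcap\mathcal{H}_{\omega_{i_2}}$, so $\{\mathcal{H}_{\omega_{i_1}},\mathcal{H}_{\omega_{i_2}}\}$ is a $2$-decomposition of $\mathcal{U}_{2,\Omega}$. In particular $\mathfrak{D}(2,\Omega)=2$.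
   Context: Graphs are finite, simple, undirected; $\mathcal{D}(G)$ is the family of inclusion-minimal dominating sets of $G$ (a dominating set is $D\subseteq V(G)$ such that every vertex outside $D$ has a neighbour in $D$). A hypergraph on $\Omega$ is a nonempty family of nonempty subsets of $\Omega$, none a proper subset of another; it has ground set $\Omega$ if the union of its members is $\Omega$. A domination hypergraph is one of the form $\mathcal{D}(G)$ for a graph $G$. $\mathcal{U}_{r,X}=\{A\subseteq X:|A|=r\}$. $K_X$ is the complete graph on $X$; the join $G_1\vee G_2$ of graphs with disjoint vertex sets adds all edges between $V(G_1)$ and $V(G_2)$ to $E(G_1)\cup E(G_2)$. $\mathcal{H}_1\leqslant\mathcal{H}_2$ means: for every $A_1\in\mathcal{H}_1$ there is $A_2\in\mathcal{H}_2$ with $A_2\subseteq A_1$. A domination completion of $\mathcal{U}_{r,\Omega}$ is a domination hypergraph with ground set $\Omega$ with $\mathcal{U}_{r,\Omega}\leqslant\mathcal{H}$; minimal ones are the $\leqslant$-minimal such. $\mathcal{H}_1\sqcap\cdots\sqcap\mathcal{H}_\ell$ is the family of inclusion-minimal sets among $\{A_1\cup\cdots\cup A_\ell:A_i\in\mathcal{H}_i\}$. A $t$-decomposition of $\mathcal{U}_{r,\Omega}$ is a family of $t$ distinct domination hypergraphs with ground set $\Omega$ whose $\sqcap$ equals $\mathcal{U}_{r,\Omega}$; $\mathfrak{D}(r,\Omega)$ is the least such $t$. -}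

module Defs where

open import Level using (Level; 0ℓ)
open import Data.Nat using (ℕ; zero; suc; _<_)
open import Data.Fin using (Fin; zero; suc)
open import Data.Fin.Subset using (Subset; _∈_; _∉_; _⊆_; _∪_; ∣_∣; ⁅_⁆; ⊤; ⊥; _-_)
open import Data.Product using (Σ; ∃; _×_; _,_)
open import Data.Sum using (_⊎_)
open import Relation.Nullary using (¬_)
open import Relation.Binary.PropositionalEquality using (_≡_; _≢_)
open import Function.Bundles using (_⇔_)

-- Universe: all vertex sets / ground sets are subsets of Fin n (Ω = Fin n).

record Graph (n : ℕ) : Set₁ where
  field
    V      : Subset n
    E      : Fin n → Fin n → Set
    sym    : ∀ {x y} → E x y → E y x
    irrefl : ∀ {x} → ¬ E x x
    closed : ∀ {x y} → E x y → x ∈ V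
open Graph public

_≅G_ : ∀ {n} → Graph n → Graph n → Set
G ≅G H = (V G ≡ V H) × (∀ x y → E G x y ⇔ E H x y)

K : ∀ {n} → Subset n → Graph n
K X = record
  { V = X
  ; E = λ x y → x ∈ X × y ∈ X × x ≢ y
  ; sym = λ { (x∈ , y∈ , x≢y) → y∈ , x∈ , λ e → x≢y (Relation.Binary.PropositionalEquality.sym e) }
  ; irrefl = λ { (_ , _ , x≢x) → x≢x Relation.Binary.PropositionalEquality.refl }
  ; closed = λ { (x∈ , _ , _) → x∈ }
  }

IsJoin : ∀ {n} → Graph n → Graph n → Graph n → Set
IsJoin G G₁ G₂ =
  (∀ x → x ∈ V G₁ → x ∉ V G₂) ×
  (V G ≡ V G₁ ∪ V G₂) ×
  (∀ x y → E G x y ⇔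
     (E G₁ x y ⊎ E G₂ x y ⊎ (x ∈ V G₁ × y ∈ V G₂) ⊎ (x ∈ V G₂ × y ∈ V G₁)))

Family : ℕ → Set₁
Family n = Subset n → Set

_≈_ : ∀ {n} → Family n → Family n → Set
H ≈ H' = ∀ A → H A ⇔ H' A

_⩽_ : ∀ {n} → Family n → Family n → Set
H₁ ⩽ H₂ = ∀ A → H₁ A → ∃ λ B → H₂ B × B ⊆ A

Minimal : ∀ {n} → Family n → Family n
Minimal P A = P A × (∀ B → P B → B ⊆ A → B ≡ A)

HasGroundSet : ∀ {n} → Family n → Subset n → Set
HasGroundSet H X = ∀ x → x ∈ X ⇔ (∃ λ A → H A × x ∈ A)

Dominating : ∀ {n} → Graph n → Subset n → Set
Dominating G D =
  D ⊆ V G × (∀ v → v ∈ V G → v ∉ D → ∃ λ u → u ∈ D × E G u v)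

𝒟 : ∀ {n} → Graph n → Family n
𝒟 G = Minimal (Dominating G)

IsDominationHypergraph : ∀ {n} → Family n → Set₁
IsDominationHypergraph {n} H = Σ (Graph n) λ G → 𝒟 G ≈ H

𝒰 : ∀ {n} → ℕ → Subset n → Family n
𝒰 r X A = A ⊆ X × ∣ A ∣ ≡ r

ℋ : ∀ {n} → Fin n → Family n
ℋ ω A = A ≡ ⁅ ω ⁆ ⊎ 𝒰 2 (⊤ - ω) A

IsDomCompletion : ∀ {n} → ℕ → Family n → Set₁
IsDomCompletion r H =
  IsDominationHypergraph H × HasGroundSet H ⊤ × (𝒰 r ⊤ ⩽ H)

IsMinDomCompletion : ∀ {n} → ℕ → Family n → Set₁
IsMinDomCompletion {n} r H =
  IsDomCompletion r H × (∀ (H' : Family n) → IsDomCompletion r H' → H' ⩽ H → H' ≈ H)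

⋃ᶠ : ∀ {n t} → (Fin t → Subset n) → Subset n
⋃ᶠ {t = zero}  as = ⊥
⋃ᶠ {t = suc t} as = as zero ∪ ⋃ᶠ (λ i → as (suc i))

Meet : ∀ {n t} → (Fin t → Family n) → Family n
Meet {n} {t} Hs = Minimal (λ A → ∃ λ (as : Fin t → Subset n) → (∀ i → Hs i (as i)) × A ≡ ⋃ᶠ as)

pair : ∀ {n} → Family n → Family n → Fin 2 → Family n
pair H₁ H₂ zero       = H₁
pair H₁ H₂ (suc zero) = H₂

IsDecomposition : ∀ {n} → ℕ → (t : ℕ) → (Fin t → Family n) → Set₁
IsDecomposition r t Hs =
  (∀ i j → i ≢ j → ¬ (Hs i ≈ Hs j)) ×
  (∀ i → IsDominationHypergraph (Hs i) × HasGroundSet (Hs i) ⊤) ×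
  (Meet Hs ≈ 𝒰 r ⊤)

HasDecomposition : ℕ → ℕ → ℕ → Set₁
HasDecomposition n r t = Σ (Fin t → Family n) λ Hs → IsDecomposition r t Hs

𝔇≡ : ℕ → ℕ → ℕ → Set₁
𝔇≡ n r t = HasDecomposition n r t × (∀ s → s < t → ¬ HasDecomposition n r s)

-- If every pair of vertices of a graph is a minimal dominating set, then no vertex dominates on
-- its own, so every vertex has a non-neighbour, and it has only one because two non-neighbours
-- of v would form a pair not dominating v.  Non-adjacency is then a fixed-point-free involution,
-- so the number of vertices is even.  Hence, for |Ω| odd, 𝒰₂ is not a domination hypergraph on Ω,
-- while on the even set Ω ∖ {ω} it is realised by the complement of a perfect matching.  Since
-- 𝒟(K_{ω} ∨ G′) = {{ω}} ∪ 𝒟(G′), this gives (1).  The same parity argument forces every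
-- domination completion of 𝒰₂ to contain a singleton {ω}, and a completion below ℋ_ω must
-- then equal it, which gives (2).  For (3), a union of a member of ℋ_{ω₁} and one of ℋ_{ω₂}
-- always contains a pair, and every pair is such a union.

module Submission where

open import Defs
open import Data.Nat using (ℕ; zero; suc; _+_; _≤_; _<_; _%_; _/_; _*_; s≤s)
open import Data.Nat.Properties using (suc-injective; <⇒≱; ≤-reflexive)
open import Data.Nat.DivMod using (m≡m%n+[m/n]*n)
open import Data.Nat.Divisibility using (n∣m⇒m%n≡0; _∣_; _∣?_; _∣0; ∣-refl; ∣m∣n⇒∣m+n)
open import Data.Fin using (Fin; zero; suc; fromℕ; punchIn; punchOut; _≟_)
open import Data.Fin.Permutation as Perm using (Permutation; _⟨$⟩ʳ_; _⟨$⟩ˡ_; inverseˡ; inverseʳ)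
open import Data.Fin.Properties as Finₚ using (any?; ∀-cons; punchInᵢ≢i; punchIn-injective; punchIn-punchOut)
open import Data.Fin.Subset
  using (Subset; _∈_; _∉_; _⊆_; _∪_; _─_; ∣_∣; ⁅_⁆; ⊤; ⊥; _-_; inside; outside; Nonempty)
open import Data.Fin.Subset.Properties
  using ( x∈⁅x⁆; x∈⁅y⁆⇒x≡y; x≢y⇒x∉⁅y⁆; x∉⁅y⁆⇒x≢y; ∣⁅x⁆∣≡1; ⊆-antisym; ⊆-trans; ∈⊤; ⊆⊤
        ; x∈p∪q⁻; x∈p∪q⁺; x∈p∧x≢y⇒x∈p-y; p─q⊆p; p─⊥≡p; nonempty?; Empty-unique; ∣⊥∣≡0
        ; p⊆q⇒∣p∣≤∣q∣; p⊂q⇒∣p∣<∣q∣; ∣⊤∣≡n; _∈?_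
        ; ∪-identityʳ; p⊆p∪q; q⊆p∪q; ∣p∣≤∣p∪q∣; ∣q∣≤∣p∪q∣)
open import Data.Vec.Base using (_∷_; here; there)
open import Data.Product using (Σ; ∃; ∃₂; _×_; _,_; proj₁; proj₂)
open import Data.Sum using (_⊎_; inj₁; inj₂; fromInj₂)
open import Relation.Nullary using (¬_; yes; no; contradiction)
open import Relation.Nullary.Decidable using (dec-true; _×-dec_; ¬?; decidable-stable)
open import Function.Base using (_∘_; case_of_)
open import Function.Bundles using (_⇔_; mk⇔; Equivalence)
open Equivalence using (to; from)
open import Function.Construct.Composition using (_⇔-∘_)
open import Function.Construct.Identity using (⇔-id)
open import Function.Construct.Symmetry using (⇔-sym)
open import Data.Sum.Function.Propositional using (_⊎-⇔_)
open import Relation.Binary.PropositionalEquality as ≡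
  using (_≡_; _≢_; refl; trans; cong; subst; subst₂)

private
  variable
    n : ℕ
    a b x y : Fin n
    p A B : Subset n

x∈p─q⇒x∉q : ∀ (p q : Subset n) → x ∈ p ─ q → x ∉ q
x∈p─q⇒x∉q (inside ∷ p) (outside ∷ q) here ()
x∈p─q⇒x∉q (_ ∷ p) (_ ∷ q) (there x∈p─q) (there x∈q) = x∈p─q⇒x∉q p q x∈p─q x∈q

x∈p-y⇒x≢y : x ∈ p - y → x ≢ y
x∈p-y⇒x≢y {p = p} {y = y} x∈p-y = x∉⁅y⁆⇒x≢y (x∈p─q⇒x∉q p ⁅ y ⁆ x∈p-y)

x∈p-y⇒x∈p : x ∈ p - y → x ∈ p
x∈p-y⇒x∈p {p = p} {y = y} = p─q⊆p p ⁅ y ⁆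

x≢y⇒x∈⊤-y : x ≢ y → x ∈ ⊤ - y
x≢y⇒x∈⊤-y = x∈p∧x≢y⇒x∈p-y ∈⊤

x∉p⇒p⊆⊤-x : x ∉ p → p ⊆ ⊤ - x
x∉p⇒p⊆⊤-x x∉p y∈p = x≢y⇒x∈⊤-y λ { refl → x∉p y∈p }

x∈p⇒⁅x⁆⊆p : x ∈ p → ⁅ x ⁆ ⊆ p
x∈p⇒⁅x⁆⊆p {x = x} x∈p y∈⁅x⁆ rewrite x∈⁅y⁆⇒x≡y x y∈⁅x⁆ = x∈p

∣p∣≡1+∣p-x∣ : ∀ (p : Subset n) x → x ∈ p → ∣ p ∣ ≡ suc ∣ p - x ∣
∣p∣≡1+∣p-x∣ (inside ∷ p) zero    here         = cong (suc ∘ ∣_∣) (≡.sym (p─⊥≡p p))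
∣p∣≡1+∣p-x∣ (inside ∷ p) (suc x) (there x∈p) = cong suc (∣p∣≡1+∣p-x∣ p x x∈p)
∣p∣≡1+∣p-x∣ (outside ∷ p) (suc x) (there x∈p) = ∣p∣≡1+∣p-x∣ p x x∈p

∣p∣≡1+k⇒Nonempty : ∀ {k} → ∣ p ∣ ≡ suc k → Nonempty p
∣p∣≡1+k⇒Nonempty {n} {p} ∣p∣≡1+k with nonempty? p
... | yes ne = ne
... | no ¬ne with () ← trans (≡.sym ∣p∣≡1+k) (trans (cong ∣_∣ (Empty-unique ¬ne)) (∣⊥∣≡0 n))

∣p∣≡1⇒p≡⁅x⁆ : ∣ p ∣ ≡ 1 → ∃ λ x → p ≡ ⁅ x ⁆
∣p∣≡1⇒p≡⁅x⁆ {p = p} ∣p∣≡1 with x , x∈p ← ∣p∣≡1+k⇒Nonempty ∣p∣≡1 =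
  x , ⊆-antisym p⊆⁅x⁆ (x∈p⇒⁅x⁆⊆p x∈p)
  where
  ∣p-x∣≡0 : ∣ p - x ∣ ≡ 0
  ∣p-x∣≡0 = suc-injective (trans (≡.sym (∣p∣≡1+∣p-x∣ p x x∈p)) ∣p∣≡1)
  p⊆⁅x⁆ : p ⊆ ⁅ x ⁆
  p⊆⁅x⁆ {y} y∈p with y ≟ x
  ... | yes refl = x∈⁅x⁆ x
  ... | no y≢x with () ← trans (≡.sym ∣p-x∣≡0) (∣p∣≡1+∣p-x∣ (p - x) y (x∈p∧x≢y⇒x∈p-y y∈p y≢x))

⊆∧∣∣≤⇒≡ : A ⊆ B → ∣ B ∣ ≤ ∣ A ∣ → A ≡ B
⊆∧∣∣≤⇒≡ {A = A} {B} A⊆B ∣B∣≤∣A∣ = ⊆-antisym A⊆B B⊆A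
  where
  B⊆A : B ⊆ A
  B⊆A {x} x∈B with x ∈? A
  ... | yes x∈A = x∈A
  ... | no x∉A = contradiction ∣B∣≤∣A∣ (<⇒≱ (p⊂q⇒∣p∣<∣q∣ (A⊆B , x , x∈B , x∉A)))

doubleton : Fin n → Fin n → Subset n
doubleton a b = ⁅ a ⁆ ∪ ⁅ b ⁆

x∈doubleton⁻ : x ∈ doubleton a b → x ≡ a ⊎ x ≡ b
x∈doubleton⁻ {a = a} {b} x∈ab with x∈p∪q⁻ ⁅ a ⁆ ⁅ b ⁆ x∈ab
... | inj₁ x∈⁅a⁆ = inj₁ (x∈⁅y⁆⇒x≡y a x∈⁅a⁆)
... | inj₂ x∈⁅b⁆ = inj₂ (x∈⁅y⁆⇒x≡y b x∈⁅b⁆)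

a∈doubleton : a ∈ doubleton a b
a∈doubleton {a = a} = x∈p∪q⁺ (inj₁ (x∈⁅x⁆ a))

b∈doubleton : b ∈ doubleton a b
b∈doubleton {b = b} = x∈p∪q⁺ (inj₂ (x∈⁅x⁆ b))

doubleton⊆ : a ∈ p → b ∈ p → doubleton a b ⊆ p
doubleton⊆ a∈p b∈p x∈ab with x∈doubleton⁻ x∈ab
... | inj₁ refl = a∈p
... | inj₂ refl = b∈p

doubleton-comm : doubleton a b ⊆ doubleton b a
doubleton-comm = doubleton⊆ b∈doubleton a∈doubleton

x≢a∧x≢b⇒x∉doubleton : x ≢ a → x ≢ b → x ∉ doubleton a b
x≢a∧x≢b⇒x∉doubleton x≢a x≢b x∈ab with x∈doubleton⁻ x∈ab
... | inj₁ x≡a = x≢a x≡a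
... | inj₂ x≡b = x≢b x≡b

⊆doubleton∧∉⇒⊆⁅⁆ : B ⊆ doubleton a b → a ∉ B → B ⊆ ⁅ b ⁆
⊆doubleton∧∉⇒⊆⁅⁆ {b = b} B⊆ab a∉B x∈B with x∈doubleton⁻ (B⊆ab x∈B)
... | inj₁ refl = contradiction x∈B a∉B
... | inj₂ refl = x∈⁅x⁆ b

∣doubleton∣≡2 : a ≢ b → ∣ doubleton a b ∣ ≡ 2
∣doubleton∣≡2 {a = a} {b} a≢b = begin
  ∣ doubleton a b ∣        ≡⟨ ∣p∣≡1+∣p-x∣ (doubleton a b) a a∈doubleton ⟩
  suc ∣ doubleton a b - a ∣ ≡⟨ cong (suc ∘ ∣_∣) ab-a≡⁅b⁆ ⟩
  suc ∣ ⁅ b ⁆ ∣             ≡⟨ cong suc (∣⁅x⁆∣≡1 b) ⟩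
  2                        ∎
  where
  open ≡.≡-Reasoning
  ab-a⊆⁅b⁆ : doubleton a b - a ⊆ ⁅ b ⁆
  ab-a⊆⁅b⁆ x∈ with x∈doubleton⁻ (x∈p-y⇒x∈p x∈)
  ... | inj₁ x≡a = contradiction x≡a (x∈p-y⇒x≢y x∈)
  ... | inj₂ refl = x∈⁅x⁆ b
  ab-a≡⁅b⁆ : doubleton a b - a ≡ ⁅ b ⁆
  ab-a≡⁅b⁆ = ⊆-antisym ab-a⊆⁅b⁆ (x∈p⇒⁅x⁆⊆p (x∈p∧x≢y⇒x∈p-y b∈doubleton (a≢b ∘ ≡.sym)))

∣p∣≡2⇒p≡doubleton : ∣ p ∣ ≡ 2 → ∃₂ λ a b → a ≢ b × p ≡ doubleton a b
∣p∣≡2⇒p≡doubleton {p = p} ∣p∣≡2 with a , a∈p ← ∣p∣≡1+k⇒Nonempty ∣p∣≡2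
  with b , p-a≡⁅b⁆ ← ∣p∣≡1⇒p≡⁅x⁆ (suc-injective (trans (≡.sym (∣p∣≡1+∣p-x∣ p a a∈p)) ∣p∣≡2)) =
  a , b , a≢b , ⊆-antisym p⊆ab (doubleton⊆ a∈p (x∈p-y⇒x∈p b∈p-a))
  where
  b∈p-a : b ∈ p - a
  b∈p-a = subst (b ∈_) (≡.sym p-a≡⁅b⁆) (x∈⁅x⁆ b)
  a≢b : a ≢ b
  a≢b a≡b = x∈p-y⇒x≢y b∈p-a (≡.sym a≡b)
  p⊆ab : p ⊆ doubleton a b
  p⊆ab {x} x∈p with x ≟ a
  ... | yes refl = a∈doubleton
  ... | no x≢a = x∈p∪q⁺ (inj₂ (subst (x ∈_) p-a≡⁅b⁆ (x∈p∧x≢y⇒x∈p-y x∈p x≢a)))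

⊆doubleton⇒≡doubleton⊎≡⁅⁆ : B ⊆ doubleton a b → Nonempty B → B ≡ doubleton a b ⊎ ∃ λ x → B ≡ ⁅ x ⁆
⊆doubleton⇒≡doubleton⊎≡⁅⁆ {B = B} {a} {b} B⊆ab (u , u∈B) with a ∈? B | b ∈? B
... | yes a∈B | yes b∈B = inj₁ (⊆-antisym B⊆ab (doubleton⊆ a∈B b∈B))
... | yes a∈B | no b∉B  = inj₂ (a , ⊆-antisym (⊆doubleton∧∉⇒⊆⁅⁆ (⊆-trans B⊆ab doubleton-comm) b∉B) (x∈p⇒⁅x⁆⊆p a∈B))
... | no a∉B  | yes b∈B = inj₂ (b , ⊆-antisym (⊆doubleton∧∉⇒⊆⁅⁆ B⊆ab a∉B) (x∈p⇒⁅x⁆⊆p b∈B))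
... | no a∉B  | no b∉B  =
  contradiction u∈B (x≢a∧x≢b⇒x∉doubleton (λ { refl → a∉B u∈B }) (λ { refl → b∉B u∈B }) ∘ B⊆ab)

avoid₂ : ∀ {m} (x y : Fin (suc (suc (suc m)))) → ∃ λ z → z ≢ x × z ≢ y
avoid₂ x y with x ≟ y
... | yes refl = punchIn x zero , punchInᵢ≢i x zero , punchInᵢ≢i x zero
... | no x≢y = punchIn x (punchIn y′ zero) , punchInᵢ≢i x _ , z≢y
  where
  y′ = punchOut x≢y
  z≢y : punchIn x (punchIn y′ zero) ≢ y
  z≢y z≡y = punchInᵢ≢i y′ zero (punchIn-injective x _ _ (trans z≡y (≡.sym (punchIn-punchOut x≢y))))

-- Parity of fixed-point-free involutions

module _ {f : Fin n → Fin n} (f-involutive : ∀ x → f (f x) ≡ x) (f-fixes-nothing : ∀ x → f x ≢ x) where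

  private
    Closed : Subset n → Set
    Closed S = ∀ {x} → x ∈ S → f x ∈ S

    ∣S∣≡2+∣S-x-fx∣ : ∀ {S x} → Closed S → x ∈ S → ∣ S ∣ ≡ 2 + ∣ S - x - f x ∣
    ∣S∣≡2+∣S-x-fx∣ {S} {x} closed x∈S =
      trans (∣p∣≡1+∣p-x∣ S x x∈S)
            (cong suc (∣p∣≡1+∣p-x∣ (S - x) (f x) (x∈p∧x≢y⇒x∈p-y (closed x∈S) (f-fixes-nothing x))))

    closed-S-x-fx : ∀ {S x} → Closed S → Closed (S - x - f x)
    closed-S-x-fx {S} {x} closed {y} y∈ =
      x∈p∧x≢y⇒x∈p-y (x∈p∧x≢y⇒x∈p-y (closed (x∈p-y⇒x∈p y∈S-x)) fy≢x) fy≢fx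
      where
      y∈S-x = x∈p-y⇒x∈p y∈
      fy≢x : f y ≢ x
      fy≢x fy≡x = x∈p-y⇒x≢y y∈ (trans (≡.sym (f-involutive y)) (cong f fy≡x))
      fy≢fx : f y ≢ f x
      fy≢fx fy≡fx = x∈p-y⇒x≢y y∈S-x (trans (≡.sym (f-involutive y)) (trans (cong f fy≡fx) (f-involutive x)))

    closed⇒2∣∣S∣ : ∀ k S → ∣ S ∣ ≡ k → Closed S → 2 ∣ k
    closed⇒2∣∣S∣ zero _ _ _ = 2 ∣0
    closed⇒2∣∣S∣ (suc k) S ∣S∣≡1+k closed
      with x , x∈S ← ∣p∣≡1+k⇒Nonempty ∣S∣≡1+k
      with k | trans (≡.sym ∣S∣≡1+k) (∣S∣≡2+∣S-x-fx∣ closed x∈S)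
    ... | zero   | ()
    ... | suc k′ | 2+k′≡2+∣S′∣ =
      ∣m∣n⇒∣m+n ∣-refl (closed⇒2∣∣S∣ k′ (S - x - f x) (≡.sym (suc-injective (suc-injective 2+k′≡2+∣S′∣)))
                                    (closed-S-x-fx closed))

  fixedPointFree-involution⇒2∣n : 2 ∣ n
  fixedPointFree-involution⇒2∣n = closed⇒2∣∣S∣ n ⊤ (∣⊤∣≡n n) (λ _ → ∈⊤)

record NearPerfectMatching (ω : Fin n) : Set where
  field
    mate            : Fin n → Fin n
    mate-involutive : ∀ x → mate (mate x) ≡ x
    mate-ω          : mate ω ≡ ω
    mate-fixed⇒≡ω   : ∀ x → mate x ≡ x → x ≡ ω

swapAdjacent : ∀ k → Fin (suc (k * 2)) → Fin (suc (k * 2))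
swapAdjacent zero    zero          = zero
swapAdjacent (suc k) zero          = suc zero
swapAdjacent (suc k) (suc zero)    = zero
swapAdjacent (suc k) (suc (suc i)) = suc (suc (swapAdjacent k i))

swapAdjacent-matching : ∀ k → NearPerfectMatching (fromℕ (k * 2))
swapAdjacent-matching k = record
  { mate            = swapAdjacent k
  ; mate-involutive = involutive k
  ; mate-ω          = fixes-last k
  ; mate-fixed⇒≡ω   = fixed⇒last k
  }
  where
  involutive : ∀ k i → swapAdjacent k (swapAdjacent k i) ≡ i
  involutive zero    zero          = refl
  involutive (suc k) zero          = refl
  involutive (suc k) (suc zero)    = refl
  involutive (suc k) (suc (suc i)) = cong (λ j → suc (suc j)) (involutive k i)
  fixes-last : ∀ k → swapAdjacent k (fromℕ (k * 2)) ≡ fromℕ (k * 2)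
  fixes-last zero    = refl
  fixes-last (suc k) = cong (λ j → suc (suc j)) (fixes-last k)
  fixed⇒last : ∀ k i → swapAdjacent k i ≡ i → i ≡ fromℕ (k * 2)
  fixed⇒last zero    zero          _ = refl
  fixed⇒last (suc k) (suc (suc i)) e =
    cong (λ j → suc (suc j)) (fixed⇒last k i (Finₚ.suc-injective (Finₚ.suc-injective e)))

conjugate : ∀ {ω₀ ω : Fin n} (π : Permutation n n) → π ⟨$⟩ʳ ω ≡ ω₀ →
            NearPerfectMatching ω₀ → NearPerfectMatching ω
conjugate {n} {ω₀} {ω} π πω≡ω₀ M = record
  { mate            = mate′
  ; mate-involutive = involutive
  ; mate-ω          = fixes-ω
  ; mate-fixed⇒≡ω   = fixed⇒≡ω
  }
  where
  open NearPerfectMatching M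
  open ≡.≡-Reasoning
  σ σ⁻¹ mate′ : Fin n → Fin n
  σ x = π ⟨$⟩ʳ x
  σ⁻¹ x = π ⟨$⟩ˡ x
  mate′ = σ⁻¹ ∘ mate ∘ σ

  involutive : ∀ x → mate′ (mate′ x) ≡ x
  involutive x = begin
    σ⁻¹ (mate (σ (σ⁻¹ (mate (σ x))))) ≡⟨ cong (σ⁻¹ ∘ mate) (inverseʳ π) ⟩
    σ⁻¹ (mate (mate (σ x)))           ≡⟨ cong σ⁻¹ (mate-involutive (σ x)) ⟩
    σ⁻¹ (σ x)                         ≡⟨ inverseˡ π ⟩
    x                                 ∎

  fixes-ω : mate′ ω ≡ ω
  fixes-ω = begin
    σ⁻¹ (mate (σ ω)) ≡⟨ cong (σ⁻¹ ∘ mate) πω≡ω₀ ⟩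
    σ⁻¹ (mate ω₀)    ≡⟨ cong σ⁻¹ (trans mate-ω (≡.sym πω≡ω₀)) ⟩
    σ⁻¹ (σ ω)        ≡⟨ inverseˡ π ⟩
    ω                ∎

  fixed⇒≡ω : ∀ x → mate′ x ≡ x → x ≡ ω
  fixed⇒≡ω x mate′x≡x = begin
    x         ≡⟨ inverseˡ π ⟨
    σ⁻¹ (σ x) ≡⟨ cong σ⁻¹ (trans (mate-fixed⇒≡ω (σ x) (trans (≡.sym (inverseʳ π)) (cong σ mate′x≡x)))
                                 (≡.sym πω≡ω₀)) ⟩
    σ⁻¹ (σ ω) ≡⟨ inverseˡ π ⟩
    ω         ∎

transpose⟨$⟩i≡j : ∀ (i j : Fin n) → Perm.transpose i j ⟨$⟩ʳ i ≡ j
transpose⟨$⟩i≡j i j rewrite dec-true (i ≟ i) refl = refl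

odd⇒≡1+[n/2]*2 : n % 2 ≡ 1 → n ≡ suc (n / 2 * 2)
odd⇒≡1+[n/2]*2 {n} odd = trans (m≡m%n+[m/n]*n n 2) (cong (_+ n / 2 * 2) odd)

odd⇒¬2∣n : n % 2 ≡ 1 → ¬ 2 ∣ n
odd⇒¬2∣n {n} odd 2∣n with () ← trans (≡.sym odd) (n∣m⇒m%n≡0 n 2 2∣n)

odd⇒nearPerfectMatching : n % 2 ≡ 1 → (ω : Fin n) → NearPerfectMatching ω
odd⇒nearPerfectMatching {n} odd =
  subst (λ m → (ω : Fin m) → NearPerfectMatching ω) (≡.sym (odd⇒≡1+[n/2]*2 odd))
    λ ω → conjugate (Perm.transpose ω last) (transpose⟨$⟩i≡j ω last) (swapAdjacent-matching (n / 2))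
  where
  last = fromℕ (n / 2 * 2)

⊎-cancelˡ-⇔ : ∀ {S P Q : Set} → (P → ¬ S) → (Q → ¬ S) → (S ⊎ P) ⇔ (S ⊎ Q) → P ⇔ Q
⊎-cancelˡ-⇔ P⇒¬S Q⇒¬S S⊎P⇔S⊎Q = mk⇔ (cancel P⇒¬S (to S⊎P⇔S⊎Q)) (cancel Q⇒¬S (from S⊎P⇔S⊎Q))
  where
  cancel : ∀ {S P Q : Set} → (P → ¬ S) → (S ⊎ P → S ⊎ Q) → P → Q
  cancel P⇒¬S f p with f (inj₂ p)
  ... | inj₁ s = contradiction s (P⇒¬S p)
  ... | inj₂ q = q

≈-sym : ∀ {H H′ : Family n} → H ≈ H′ → H′ ≈ H
≈-sym H≈H′ A = ⇔-sym (H≈H′ A)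

≈-trans : ∀ {H H′ H″ : Family n} → H ≈ H′ → H′ ≈ H″ → H ≈ H″
≈-trans H≈H′ H′≈H″ A = H′≈H″ A ⇔-∘ H≈H′ A

⩽-respʳ-≈ : ∀ {F H H′ : Family n} → H ≈ H′ → F ⩽ H → F ⩽ H′
⩽-respʳ-≈ H≈H′ F⩽H A FA with B , HB , B⊆A ← F⩽H A FA = B , to (H≈H′ B) HB , B⊆A

IsDomCompletion-resp-≈ : ∀ {r} {H H′ : Family n} → H ≈ H′ → IsDomCompletion r H → IsDomCompletion r H′
IsDomCompletion-resp-≈ H≈H′ ((G , 𝒟≈H) , ground , 𝒰⩽H) =
  (G , ≈-trans 𝒟≈H H≈H′) ,
  (λ x → mk⇔ (move H≈H′ ∘ to (ground x)) (from (ground x) ∘ move (≈-sym H≈H′))) ,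
  ⩽-respʳ-≈ H≈H′ 𝒰⩽H
  where
  move : ∀ {x} {F F′ : Family _} → F ≈ F′ → (∃ λ A → F A × x ∈ A) → ∃ λ A → F′ A × x ∈ A
  move F≈F′ (A , FA , x∈A) = A , to (F≈F′ A) FA , x∈A

Antichain : Family n → Set
Antichain H = ∀ {A B} → H A → H B → B ⊆ A → B ≡ A

IsDominationHypergraph⇒Antichain : ∀ {H : Family n} → IsDominationHypergraph H → Antichain H
IsDominationHypergraph⇒Antichain (_ , 𝒟≈H) HA HB B⊆A =
  proj₂ (from (𝒟≈H _) HA) _ (proj₁ (from (𝒟≈H _) HB)) B⊆A

𝒰-Antichain : ∀ {r} {X : Subset n} → Antichain (𝒰 r X)
𝒰-Antichain (_ , ∣A∣≡r) (_ , ∣B∣≡r) B⊆A = ⊆∧∣∣≤⇒≡ B⊆A (≤-reflexive (trans ∣A∣≡r (≡.sym ∣B∣≡r)))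

Antichain∧⊇∧⩽⇒≈ : ∀ {H F : Family n} → Antichain H → (∀ A → F A → H A) → H ⩽ F → H ≈ F
Antichain∧⊇∧⩽⇒≈ {H = H} {F} antichain F⊆H H⩽F A = mk⇔ H⇒F (F⊆H A)
  where
  H⇒F : H A → F A
  H⇒F HA with B , FB , B⊆A ← H⩽F A HA = subst F (antichain HA (F⊆H B FB) B⊆A) FB

Minimal≈Antichain : ∀ {P F : Family n} → Antichain F → (∀ A → F A → P A) → P ⩽ F → Minimal P ≈ F
Minimal≈Antichain {P = P} {F} antichain F⊆P P⩽F A = mk⇔ minimal⇒F F⇒minimal
  where
  minimal⇒F : Minimal P A → F A
  minimal⇒F (PA , minimal) with B , FB , B⊆A ← P⩽F A PA = subst F (minimal B (F⊆P B FB) B⊆A) FB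
  F⇒minimal : F A → Minimal P A
  F⇒minimal FA = F⊆P A FA , λ B PB B⊆A → case P⩽F B PB of λ where
    (C , FC , C⊆B) → ⊆-antisym B⊆A (subst (_⊆ B) (antichain FA FC (⊆-trans C⊆B B⊆A)) C⊆B)

Dominating⇒Nonempty : ∀ {G : Graph n} {D} → Dominating G D → x ∈ V G → Nonempty D
Dominating⇒Nonempty {x = x} {D = D} (_ , dominated) x∈V with x ∈? D
... | yes x∈D = x , x∈D
... | no x∉D with u , u∈D , _ ← dominated x x∈V x∉D = u , u∈D

⁅x⁆-dominates⇒adjacent : ∀ {G : Graph n} → Dominating G ⁅ x ⁆ → y ∈ V G → y ≢ x → E G x y
⁅x⁆-dominates⇒adjacent {x = x} (_ , dominated) y∈V y≢x
  with u , u∈⁅x⁆ , e ← dominated _ y∈V (x≢y⇒x∉⁅y⁆ y≢x) rewrite x∈⁅y⁆⇒x≡y x u∈⁅x⁆ = e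

Minimal-transfer : ∀ {P Q : Family n} {X} → (∀ {B} → B ⊆ X → P B → Q B) → (∀ {B} → B ⊆ X → Q B → P B) →
                   A ⊆ X → Minimal P A → Minimal Q A
Minimal-transfer P⇒Q Q⇒P A⊆X (PA , minimal) =
  P⇒Q A⊆X PA , λ B QB B⊆A → minimal B (Q⇒P (⊆-trans B⊆A A⊆X) QB) B⊆A

module _ {ω : Fin n} (M : NearPerfectMatching ω) where
  open NearPerfectMatching M

  mate-≢ω : x ≢ ω → mate x ≢ ω
  mate-≢ω {x} x≢ω mx≡ω = x≢ω (trans (≡.sym (mate-involutive x)) (trans (cong mate mx≡ω) mate-ω))

  mate-≢ : x ≢ ω → mate x ≢ x
  mate-≢ x≢ω mx≡x = x≢ω (mate-fixed⇒≡ω _ mx≡x)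

  cocktailParty : Graph n
  cocktailParty = record
    { V      = ⊤ - ω
    ; E      = λ x y → x ≢ ω × y ≢ ω × x ≢ y × y ≢ mate x
    ; sym    = λ { {x} {y} (x≢ω , y≢ω , x≢y , y≢mx) → y≢ω , x≢ω , x≢y ∘ ≡.sym ,
                   λ x≡my → y≢mx (trans (≡.sym (mate-involutive y)) (cong mate (≡.sym x≡my))) }
    ; irrefl = λ { (_ , _ , x≢x , _) → x≢x refl }
    ; closed = λ { (x≢ω , _) → x≢y⇒x∈⊤-y x≢ω }
    }

  doubleton-dominates : a ≢ b → a ≢ ω → b ≢ ω → Dominating cocktailParty (doubleton a b)
  doubleton-dominates {a} {b} a≢b a≢ω b≢ω = ab⊆V , dominated
    where
    ab⊆V : doubleton a b ⊆ ⊤ - ω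
    ab⊆V = doubleton⊆ (x≢y⇒x∈⊤-y a≢ω) (x≢y⇒x∈⊤-y b≢ω)
    dominated : ∀ v → v ∈ ⊤ - ω → v ∉ doubleton a b → ∃ λ u → u ∈ doubleton a b × E cocktailParty u v
    dominated v v∈V v∉ab with mate v ≟ a
    ... | yes mv≡a = b , b∈doubleton , b≢ω , x∈p-y⇒x≢y v∈V , (λ b≡v → v∉ab (subst (_∈ _) b≡v b∈doubleton)) ,
                     λ v≡mb → a≢b (trans (≡.sym mv≡a) (trans (cong mate v≡mb) (mate-involutive b)))
    ... | no mv≢a  = a , a∈doubleton , a≢ω , x∈p-y⇒x≢y v∈V , (λ a≡v → v∉ab (subst (_∈ _) a≡v a∈doubleton)) ,
                     λ v≡ma → mv≢a (trans (cong mate v≡ma) (mate-involutive a))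

  ⊆⁅⁆-¬dominates : b ≢ ω → B ⊆ ⁅ b ⁆ → ¬ Dominating cocktailParty B
  ⊆⁅⁆-¬dominates {b} {B} b≢ω B⊆⁅b⁆ (_ , dominated) with dominated (mate b) (x≢y⇒x∈⊤-y (mate-≢ω b≢ω)) mb∉B
    where
    mb∉B : mate b ∉ B
    mb∉B mb∈B = mate-≢ b≢ω (x∈⁅y⁆⇒x≡y b (B⊆⁅b⁆ mb∈B))
  ... | u , u∈B , (_ , _ , _ , mb≢mu) rewrite x∈⁅y⁆⇒x≡y b (B⊆⁅b⁆ u∈B) = mb≢mu refl

  doubleton∈𝒟 : a ≢ b → a ≢ ω → b ≢ ω → 𝒟 cocktailParty (doubleton a b)
  doubleton∈𝒟 {a} {b} a≢b a≢ω b≢ω = doubleton-dominates a≢b a≢ω b≢ω , λ B dom B⊆ab →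
    ⊆-antisym B⊆ab (doubleton⊆ (∈B b≢ω dom B⊆ab) (∈B a≢ω dom (⊆-trans B⊆ab doubleton-comm)))
    where
    ∈B : ∀ {x y B} → y ≢ ω → Dominating cocktailParty B → B ⊆ doubleton x y → x ∈ B
    ∈B {x} {y} {B} y≢ω dom B⊆xy with x ∈? B
    ... | yes x∈B = x∈B
    ... | no x∉B = contradiction dom (⊆⁅⁆-¬dominates y≢ω (⊆doubleton∧∉⇒⊆⁅⁆ B⊆xy x∉B))

  𝒟-cocktailParty : ∀ {w} → w ≢ ω → 𝒟 cocktailParty ≈ 𝒰 2 (⊤ - ω)
  𝒟-cocktailParty w≢ω A = mk⇔ minimal⇒pair pair⇒minimal
    where
    minimal⇒pair : 𝒟 cocktailParty A → 𝒰 2 (⊤ - ω) A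
    minimal⇒pair (dom@(A⊆V , _) , minimal)
      with a , a∈A ← Dominating⇒Nonempty {G = cocktailParty} dom (x≢y⇒x∈⊤-y w≢ω)
      with any? (λ b → (b ∈? A) ×-dec ¬? (b ≟ a))
    ... | yes (b , b∈A , b≢a) =
      A⊆V , subst (λ X → ∣ X ∣ ≡ 2) ab≡A (∣doubleton∣≡2 (b≢a ∘ ≡.sym))
      where
      ab≡A : doubleton a b ≡ A
      ab≡A = minimal (doubleton a b)
        (doubleton-dominates (b≢a ∘ ≡.sym) (x∈p-y⇒x≢y (A⊆V a∈A)) (x∈p-y⇒x≢y (A⊆V b∈A)))
        (doubleton⊆ a∈A b∈A)
    ... | no ∄b = contradiction dom (⊆⁅⁆-¬dominates (x∈p-y⇒x≢y (A⊆V a∈A)) A⊆⁅a⁆)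
      where
      A⊆⁅a⁆ : A ⊆ ⁅ a ⁆
      A⊆⁅a⁆ {x} x∈A with x ≟ a
      ... | yes refl = x∈⁅x⁆ a
      ... | no x≢a = contradiction (x , x∈A , x≢a) ∄b
    pair⇒minimal : 𝒰 2 (⊤ - ω) A → 𝒟 cocktailParty A
    pair⇒minimal (A⊆V , ∣A∣≡2) with a , b , a≢b , A≡ab ← ∣p∣≡2⇒p≡doubleton ∣A∣≡2 =
      subst (𝒟 cocktailParty) (≡.sym A≡ab)
        (doubleton∈𝒟 a≢b (x∈p-y⇒x≢y (A⊆V a∈A)) (x∈p-y⇒x≢y (A⊆V b∈A)))
      where
      a∈A = subst (a ∈_) (≡.sym A≡ab) a∈doubleton
      b∈A = subst (b ∈_) (≡.sym A≡ab) b∈doubleton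

-- Cones

record IsCone (G : Graph n) (ω : Fin n) (G′ : Graph n) : Set where
  field
    spanning : ∀ x → x ∈ V G
    V-base   : V G′ ≡ ⊤ - ω
    base⇒E   : ∀ {x y} → E G′ x y → E G x y
    E⇒base   : ∀ {x y} → x ≢ ω → y ≢ ω → E G x y → E G′ x y
    apex-adj : ∀ {y} → y ≢ ω → E G ω y

cone : Graph n → Fin n → Graph n
cone G′ ω = record
  { V      = ⊤
  ; E      = λ x y → E G′ x y ⊎ (x ≡ ω × y ≢ ω) ⊎ (x ≢ ω × y ≡ ω)
  ; sym    = λ { (inj₁ e)                → inj₁ (sym G′ e)
               ; (inj₂ (inj₁ (x≡ω , y≢ω))) → inj₂ (inj₂ (y≢ω , x≡ω))
               ; (inj₂ (inj₂ (x≢ω , y≡ω))) → inj₂ (inj₁ (y≡ω , x≢ω)) }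
  ; irrefl = λ { (inj₁ e)                → irrefl G′ e
               ; (inj₂ (inj₁ (x≡ω , x≢ω))) → x≢ω x≡ω
               ; (inj₂ (inj₂ (x≢ω , x≡ω))) → x≢ω x≡ω }
  ; closed = λ _ → ∈⊤
  }

cone-IsCone : ∀ {G′ : Graph n} {ω} → V G′ ≡ ⊤ - ω → IsCone (cone G′ ω) ω G′
cone-IsCone V-base = record
  { spanning = λ _ → ∈⊤
  ; V-base   = V-base
  ; base⇒E   = inj₁
  ; E⇒base   = λ { _ _ (inj₁ e) → e
                 ; x≢ω _ (inj₂ (inj₁ (x≡ω , _))) → contradiction x≡ω x≢ω
                 ; _ y≢ω (inj₂ (inj₂ (_ , y≡ω))) → contradiction y≡ω y≢ω }
  ; apex-adj = λ y≢ω → inj₂ (inj₁ (refl , y≢ω))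
  }

_∖_ : Graph n → Fin n → Graph n
G ∖ ω = record
  { V      = V G - ω
  ; E      = λ x y → E G x y × x ≢ ω × y ≢ ω
  ; sym    = λ { (e , x≢ω , y≢ω) → sym G e , y≢ω , x≢ω }
  ; irrefl = λ { (e , _) → irrefl G e }
  ; closed = λ { (e , x≢ω , _) → x∈p∧x≢y⇒x∈p-y (closed G e) x≢ω }
  }

∖-IsCone : ∀ {G : Graph n} {ω} → V G ≡ ⊤ → (∀ {y} → y ≢ ω → E G ω y) → IsCone G ω (G ∖ ω)
∖-IsCone {ω = ω} V≡⊤ apex-adj = record
  { spanning = λ x → subst (x ∈_) (≡.sym V≡⊤) ∈⊤
  ; V-base   = cong (_- ω) V≡⊤
  ; base⇒E   = proj₁
  ; E⇒base   = λ x≢ω y≢ω e → e , x≢ω , y≢ω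
  ; apex-adj = apex-adj
  }

⁅ω⁆∪[⊤-ω]≡⊤ : ∀ (ω : Fin n) → ⁅ ω ⁆ ∪ (⊤ - ω) ≡ ⊤
⁅ω⁆∪[⊤-ω]≡⊤ ω = ⊆-antisym ⊆⊤ ⊤⊆
  where
  ⊤⊆ : ⊤ ⊆ ⁅ ω ⁆ ∪ (⊤ - ω)
  ⊤⊆ {x} _ with x ≟ ω
  ... | yes refl = x∈p∪q⁺ (inj₁ (x∈⁅x⁆ ω))
  ... | no x≢ω = x∈p∪q⁺ (inj₂ (x≢y⇒x∈⊤-y x≢ω))

IsCone⇒IsJoin : ∀ {G G′ : Graph n} {ω} → IsCone G ω G′ → IsJoin G (K ⁅ ω ⁆) G′
IsCone⇒IsJoin {G = G} {G′} {ω} c = disjoint , V-union , λ x y → mk⇔ (split x y) (merge x y)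
  where
  open IsCone c
  base⇒≢ω : ∀ {x} → x ∈ V G′ → x ≢ ω
  base⇒≢ω {x} x∈V′ = x∈p-y⇒x≢y (subst (x ∈_) V-base x∈V′)
  ≢ω⇒base : ∀ {x} → x ≢ ω → x ∈ V G′
  ≢ω⇒base {x} x≢ω = subst (x ∈_) (≡.sym V-base) (x≢y⇒x∈⊤-y x≢ω)
  disjoint : ∀ x → x ∈ ⁅ ω ⁆ → x ∉ V G′
  disjoint x x∈⁅ω⁆ x∈V′ = base⇒≢ω x∈V′ (x∈⁅y⁆⇒x≡y ω x∈⁅ω⁆)
  V-union : V G ≡ ⁅ ω ⁆ ∪ V G′
  V-union = begin
    V G               ≡⟨ ⊆-antisym ⊆⊤ (λ {x} _ → spanning x) ⟩
    ⊤                 ≡⟨ ⁅ω⁆∪[⊤-ω]≡⊤ ω ⟨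
    ⁅ ω ⁆ ∪ (⊤ - ω)   ≡⟨ cong (⁅ ω ⁆ ∪_) V-base ⟨
    ⁅ ω ⁆ ∪ V G′      ∎
    where open ≡.≡-Reasoning
  split : ∀ x y → E G x y → E (K ⁅ ω ⁆) x y ⊎ E G′ x y ⊎ (x ∈ ⁅ ω ⁆ × y ∈ V G′) ⊎ (x ∈ V G′ × y ∈ ⁅ ω ⁆)
  split x y e with x ≟ ω | y ≟ ω
  ... | yes refl | yes refl = contradiction e (irrefl G)
  ... | yes refl | no y≢ω   = inj₂ (inj₂ (inj₁ (x∈⁅x⁆ ω , ≢ω⇒base y≢ω)))
  ... | no x≢ω   | yes refl = inj₂ (inj₂ (inj₂ (≢ω⇒base x≢ω , x∈⁅x⁆ ω)))
  ... | no x≢ω   | no y≢ω   = inj₂ (inj₁ (E⇒base x≢ω y≢ω e))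
  merge : ∀ x y → E (K ⁅ ω ⁆) x y ⊎ E G′ x y ⊎ (x ∈ ⁅ ω ⁆ × y ∈ V G′) ⊎ (x ∈ V G′ × y ∈ ⁅ ω ⁆) → E G x y
  merge x y (inj₁ (x∈⁅ω⁆ , y∈⁅ω⁆ , x≢y)) = contradiction (trans (x∈⁅y⁆⇒x≡y ω x∈⁅ω⁆) (≡.sym (x∈⁅y⁆⇒x≡y ω y∈⁅ω⁆))) x≢y
  merge x y (inj₂ (inj₁ e)) = base⇒E e
  merge x y (inj₂ (inj₂ (inj₁ (x∈⁅ω⁆ , y∈V′)))) rewrite x∈⁅y⁆⇒x≡y ω x∈⁅ω⁆ = apex-adj (base⇒≢ω y∈V′)
  merge x y (inj₂ (inj₂ (inj₂ (x∈V′ , y∈⁅ω⁆)))) rewrite x∈⁅y⁆⇒x≡y ω y∈⁅ω⁆ = sym G (apex-adj (base⇒≢ω x∈V′))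

IsJoin⇒IsCone : ∀ {G G′ : Graph n} {ω} → V G ≡ ⊤ → V G′ ≡ ⊤ - ω → IsJoin G (K ⁅ ω ⁆) G′ → IsCone G ω G′
IsJoin⇒IsCone {G = G} {G′} {ω} V≡⊤ V-base (_ , _ , edges) = record
  { spanning = λ x → subst (x ∈_) (≡.sym V≡⊤) ∈⊤
  ; V-base   = V-base
  ; base⇒E   = λ {x} {y} e → from (edges x y) (inj₂ (inj₁ e))
  ; E⇒base   = E⇒base
  ; apex-adj = λ {y} y≢ω → from (edges ω y)
      (inj₂ (inj₂ (inj₁ (x∈⁅x⁆ ω , subst (y ∈_) (≡.sym V-base) (x≢y⇒x∈⊤-y y≢ω)))))
  }
  where
  E⇒base : ∀ {x y} → x ≢ ω → y ≢ ω → E G x y → E G′ x y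
  E⇒base {x} {y} x≢ω y≢ω e with to (edges x y) e
  ... | inj₁ (x∈⁅ω⁆ , _)              = contradiction (x∈⁅y⁆⇒x≡y ω x∈⁅ω⁆) x≢ω
  ... | inj₂ (inj₁ e′)                = e′
  ... | inj₂ (inj₂ (inj₁ (x∈⁅ω⁆ , _))) = contradiction (x∈⁅y⁆⇒x≡y ω x∈⁅ω⁆) x≢ω
  ... | inj₂ (inj₂ (inj₂ (_ , y∈⁅ω⁆))) = contradiction (x∈⁅y⁆⇒x≡y ω y∈⁅ω⁆) y≢ω

module _ {G G′ : Graph n} {ω} (c : IsCone G ω G′) where
  open IsCone c

  private
    ∉⁅⁆ : A ⊆ ⊤ - ω → A ≢ ⁅ ω ⁆
    ∉⁅⁆ A⊆ A≡⁅ω⁆ = x∈p-y⇒x≢y (A⊆ (subst (ω ∈_) (≡.sym A≡⁅ω⁆) (x∈⁅x⁆ ω))) refl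

    V′⊆ : V G′ ⊆ ⊤ - ω
    V′⊆ {x} = subst (x ∈_) V-base

  Dominating-base⇒cone : ∀ {w B} → w ≢ ω → B ⊆ ⊤ - ω → Dominating G′ B → Dominating G B
  Dominating-base⇒cone {w} {B} w≢ω B⊆ dom@(_ , dominated) = (λ {x} _ → spanning x) , dominated′
    where
    dominated′ : ∀ v → v ∈ V G → v ∉ B → ∃ λ u → u ∈ B × E G u v
    dominated′ v _ v∉B with v ≟ ω
    ... | yes refl with u , u∈B ← Dominating⇒Nonempty {G = G′} dom (subst (w ∈_) (≡.sym V-base) (x≢y⇒x∈⊤-y w≢ω)) =
      u , u∈B , sym G (apex-adj (x∈p-y⇒x≢y (B⊆ u∈B)))
    ... | no v≢ω with u , u∈B , e ← dominated v (subst (v ∈_) (≡.sym V-base) (x≢y⇒x∈⊤-y v≢ω)) v∉B =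
      u , u∈B , base⇒E e

  Dominating-cone⇒base : B ⊆ ⊤ - ω → Dominating G B → Dominating G′ B
  Dominating-cone⇒base {B} B⊆ (_ , dominated) = (λ {x} x∈B → subst (x ∈_) (≡.sym V-base) (B⊆ x∈B)) , dominated′
    where
    dominated′ : ∀ v → v ∈ V G′ → v ∉ B → ∃ λ u → u ∈ B × E G′ u v
    dominated′ v v∈V′ v∉B with u , u∈B , e ← dominated v (spanning v) v∉B =
      u , u∈B , E⇒base (x∈p-y⇒x≢y (B⊆ u∈B)) (x∈p-y⇒x≢y (V′⊆ v∈V′)) e

  ⁅apex⁆∈𝒟 : 𝒟 G ⁅ ω ⁆
  ⁅apex⁆∈𝒟 = dom , minimal
    where
    dom : Dominating G ⁅ ω ⁆
    dom = (λ {x} _ → spanning x) , λ v _ v∉⁅ω⁆ → ω , x∈⁅x⁆ ω , apex-adj (x∉⁅y⁆⇒x≢y v∉⁅ω⁆)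
    minimal : ∀ B → Dominating G B → B ⊆ ⁅ ω ⁆ → B ≡ ⁅ ω ⁆
    minimal B domB B⊆ with u , u∈B ← Dominating⇒Nonempty {G = G} domB (spanning ω)
      = ⊆-antisym B⊆ (x∈p⇒⁅x⁆⊆p (subst (_∈ B) (x∈⁅y⁆⇒x≡y ω (B⊆ u∈B)) u∈B))

  𝒟-cone : ∀ {w A} → w ≢ ω → 𝒟 G A ⇔ (A ≡ ⁅ ω ⁆ ⊎ 𝒟 G′ A)
  𝒟-cone {w} {A} w≢ω = mk⇔ split merge
    where
    split : 𝒟 G A → A ≡ ⁅ ω ⁆ ⊎ 𝒟 G′ A
    split (domA , minimal) with ω ∈? A
    ... | yes ω∈A = inj₁ (≡.sym (minimal ⁅ ω ⁆ (proj₁ ⁅apex⁆∈𝒟) (x∈p⇒⁅x⁆⊆p ω∈A)))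
    ... | no ω∉A = inj₂ (Minimal-transfer Dominating-cone⇒base (Dominating-base⇒cone w≢ω) (x∉p⇒p⊆⊤-x ω∉A)
                                          (domA , minimal))
    merge : A ≡ ⁅ ω ⁆ ⊎ 𝒟 G′ A → 𝒟 G A
    merge (inj₁ refl) = ⁅apex⁆∈𝒟
    merge (inj₂ 𝒟′A@((A⊆V′ , _) , _)) =
      Minimal-transfer (Dominating-base⇒cone w≢ω) Dominating-cone⇒base (V′⊆ ∘ A⊆V′) 𝒟′A

  𝒟≈ℋ⇔𝒟-base≈𝒰 : ∀ {w} → w ≢ ω → 𝒟 G ≈ ℋ ω ⇔ 𝒟 G′ ≈ 𝒰 2 (⊤ - ω)
  𝒟≈ℋ⇔𝒟-base≈𝒰 w≢ω =
    mk⇔ (λ 𝒟≈ℋ A → ⊎-cancelˡ-⇔ (¬singleton′ A) (¬singleton A) (𝒟≈ℋ A ⇔-∘ ⇔-sym (𝒟-cone w≢ω)))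
        (λ 𝒟′≈𝒰 A → (⇔-id _ ⊎-⇔ 𝒟′≈𝒰 A) ⇔-∘ 𝒟-cone w≢ω)
    where
    ¬singleton′ : ∀ A → 𝒟 G′ A → A ≢ ⁅ ω ⁆
    ¬singleton′ A ((A⊆V′ , _) , _) = ∉⁅⁆ (V′⊆ ∘ A⊆V′)
    ¬singleton : ∀ A → 𝒰 2 (⊤ - ω) A → A ≢ ⁅ ω ⁆
    ¬singleton A (A⊆ , _) = ∉⁅⁆ A⊆

ℋ-IsDominationHypergraph : ∀ {ω w : Fin n} → NearPerfectMatching ω → w ≢ ω → IsDominationHypergraph (ℋ ω)
ℋ-IsDominationHypergraph {ω = ω} M w≢ω =
  cone (cocktailParty M) ω ,
  from (𝒟≈ℋ⇔𝒟-base≈𝒰 (cone-IsCone {G′ = cocktailParty M} refl) w≢ω) (𝒟-cocktailParty M w≢ω)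

𝒟≈ℋ⇔IsJoin : ∀ {ω w : Fin n} {G : Graph n} → w ≢ ω → V G ≡ ⊤ →
  𝒟 G ≈ ℋ ω ⇔ (Σ (Graph n) λ G′ → (V G′ ≡ ⊤ - ω) × (𝒟 G′ ≈ 𝒰 2 (⊤ - ω)) × IsJoin G (K ⁅ ω ⁆) G′)
𝒟≈ℋ⇔IsJoin {n} {ω} {G = G} w≢ω V≡⊤ = mk⇔ split merge
  where
  split : 𝒟 G ≈ ℋ ω → Σ (Graph n) λ G′ → (V G′ ≡ ⊤ - ω) × (𝒟 G′ ≈ 𝒰 2 (⊤ - ω)) × IsJoin G (K ⁅ ω ⁆) G′
  split 𝒟≈ℋ = G ∖ ω , cong (_- ω) V≡⊤ , to (𝒟≈ℋ⇔𝒟-base≈𝒰 c w≢ω) 𝒟≈ℋ , IsCone⇒IsJoin c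
    where
    ⁅ω⁆-dominates : Dominating G ⁅ ω ⁆
    ⁅ω⁆-dominates = proj₁ (from (𝒟≈ℋ ⁅ ω ⁆) (inj₁ refl))
    c : IsCone G ω (G ∖ ω)
    c = ∖-IsCone {G = G} V≡⊤ λ {y} → ⁅x⁆-dominates⇒adjacent {G = G} ⁅ω⁆-dominates (subst (y ∈_) (≡.sym V≡⊤) ∈⊤)
  merge : (Σ (Graph n) λ G′ → (V G′ ≡ ⊤ - ω) × (𝒟 G′ ≈ 𝒰 2 (⊤ - ω)) × IsJoin G (K ⁅ ω ⁆) G′) → 𝒟 G ≈ ℋ ω
  merge (G′ , V-base , 𝒟′≈𝒰 , join) =
    from (𝒟≈ℋ⇔𝒟-base≈𝒰 (IsJoin⇒IsCone {G = G} {G′} V≡⊤ V-base join) w≢ω) 𝒟′≈𝒰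

-- Graphs in which every pair is a minimal dominating set

¬¬-∀ : ∀ {P : Fin n → Set} → (∀ i → ¬ ¬ P i) → ¬ ¬ (∀ i → P i)
¬¬-∀ {zero}  _   ¬∀P = ¬∀P λ ()
¬¬-∀ {suc n} ¬¬P ¬∀P = ¬¬P zero λ P₀ → ¬¬-∀ (¬¬P ∘ suc) λ Pₛ → ¬∀P (∀-cons P₀ Pₛ)

∀-⊎ : ∀ {P : Fin n → Set} {R : Set} → (∀ i → P i ⊎ R) → (∀ i → P i) ⊎ R
∀-⊎ {zero}  _ = inj₁ λ ()
∀-⊎ {suc n} P⊎R with P⊎R zero | ∀-⊎ (P⊎R ∘ suc)
... | inj₁ P₀ | inj₁ Pₛ = inj₁ (∀-cons P₀ Pₛ)
... | inj₁ _  | inj₂ r  = inj₂ r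
... | inj₂ r  | _       = inj₂ r

-- Each vertex has exactly one non-neighbour, so non-adjacency is a fixed-point-free involution.
-- Constructively the non-neighbour only exists under double negation; this suffices as 2 ∣ n is decidable.
doubletons∈𝒟⇒2∣n : ∀ (G : Graph n) → (∀ v → ∃ λ w → w ≢ v) → (∀ a b → a ≢ b → 𝒟 G (doubleton a b)) → 2 ∣ n
doubletons∈𝒟⇒2∣n {n} G other doubletons = decidable-stable (2 ∣? n) λ ¬2∣n →
  ¬¬-∀ non-neighbour λ f → ¬2∣n (fixedPointFree-involution⇒2∣n (involutive f) (proj₁ ∘ proj₂ ∘ f))
  where
  NonNeighbour : Fin n → Fin n → Set
  NonNeighbour v w = w ≢ v × ¬ E G v w

  spanning : ∀ v → v ∈ V G
  spanning v with w , w≢v ← other v = proj₁ (proj₁ (doubletons v w (w≢v ∘ ≡.sym))) a∈doubleton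

  non-neighbour : ∀ v → ¬ ¬ ∃ (NonNeighbour v)
  non-neighbour v ∄ = ¬¬-∀ adjacent ⁅v⁆-¬dominates
    where
    adjacent : ∀ w → ¬ ¬ (w ≢ v → E G v w)
    adjacent w ¬adj = ¬adj λ w≢v → contradiction (w , w≢v , λ vw → ¬adj λ _ → vw) ∄
    ⁅v⁆-¬dominates : ¬ (∀ w → w ≢ v → E G v w)
    ⁅v⁆-¬dominates adj with w , w≢v ← other v = w≢v (x∈⁅y⁆⇒x≡y v (subst (w ∈_) (≡.sym vw≡⁅v⁆) b∈doubleton))
      where
      vw≡⁅v⁆ : ⁅ v ⁆ ≡ doubleton v w
      vw≡⁅v⁆ = proj₂ (doubletons v w (w≢v ∘ ≡.sym)) ⁅ v ⁆
        ((λ {x} _ → spanning x) , λ u _ u∉⁅v⁆ → v , x∈⁅x⁆ v , adj u (x∉⁅y⁆⇒x≢y u∉⁅v⁆))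
        (λ x∈⁅v⁆ → x∈p∪q⁺ (inj₁ x∈⁅v⁆))

  unique : ∀ {v w w′} → NonNeighbour v w → NonNeighbour v w′ → w ≡ w′
  unique {v} {w} {w′} (w≢v , ¬vw) (w′≢v , ¬vw′) with w ≟ w′
  ... | yes w≡w′ = w≡w′
  ... | no w≢w′ with u , u∈ww′ , uv ← proj₂ (proj₁ (doubletons w w′ w≢w′)) v (spanning v)
                                        (x≢a∧x≢b⇒x∉doubleton (w≢v ∘ ≡.sym) (w′≢v ∘ ≡.sym))
                with x∈doubleton⁻ u∈ww′
  ... | inj₁ refl = contradiction (sym G uv) ¬vw
  ... | inj₂ refl = contradiction (sym G uv) ¬vw′

  involutive : (f : ∀ v → ∃ (NonNeighbour v)) → ∀ v → proj₁ (f (proj₁ (f v))) ≡ v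
  involutive f v with w , w≢v , ¬vw ← f v = unique (proj₂ (f w)) ((w≢v ∘ ≡.sym) , ¬vw ∘ sym G)

-- Domination completions

-- A completion either contains a singleton or has every pair as a minimal dominating set.
DomCompletion⇒singleton : ∀ {H : Family n} → ¬ 2 ∣ n → (∀ v → ∃ λ w → w ≢ v) →
                          IsDomCompletion 2 H → ∃ λ ω → H ⁅ ω ⁆
DomCompletion⇒singleton {H = H} ¬2∣n other ((G , 𝒟≈H) , ground , 𝒰⩽H) =
  fromInj₂ (λ doubletons → contradiction (doubletons∈𝒟⇒2∣n G other doubletons) ¬2∣n)
           (∀-⊎ (λ a → ∀-⊎ (doubleton∈𝒟⊎singleton a)))
  where
  spanning : ∀ v → v ∈ V G
  spanning v with A , HA , v∈A ← to (ground v) ∈⊤ = proj₁ (proj₁ (from (𝒟≈H A) HA)) v∈A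

  doubleton∈𝒟⊎singleton : ∀ a b → (a ≢ b → 𝒟 G (doubleton a b)) ⊎ ∃ λ ω → H ⁅ ω ⁆
  doubleton∈𝒟⊎singleton a b with a ≟ b
  ... | yes a≡b = inj₁ λ a≢b → contradiction a≡b a≢b
  ... | no a≢b with B , HB , B⊆ab ← 𝒰⩽H (doubleton a b) (⊆⊤ , ∣doubleton∣≡2 a≢b)
    with 𝒟B ← from (𝒟≈H B) HB
    with ⊆doubleton⇒≡doubleton⊎≡⁅⁆ B⊆ab (Dominating⇒Nonempty {G = G} (proj₁ 𝒟B) (spanning a))
  ... | inj₁ B≡ab       = inj₁ λ _ → subst (𝒟 G) B≡ab 𝒟B
  ... | inj₂ (x , B≡⁅x⁆) = inj₂ (x , subst H B≡⁅x⁆ HB)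

ℋ-injective : ∀ {ω ω′ : Fin n} → ℋ ω ≈ ℋ ω′ → ω ≡ ω′
ℋ-injective {ω = ω} {ω′} ℋω≈ℋω′ with to (ℋω≈ℋω′ ⁅ ω ⁆) (inj₁ refl)
... | inj₁ ⁅ω⁆≡⁅ω′⁆ = x∈⁅y⁆⇒x≡y ω′ (subst (ω ∈_) ⁅ω⁆≡⁅ω′⁆ (x∈⁅x⁆ ω))
... | inj₂ (_ , ∣⁅ω⁆∣≡2) with () ← trans (≡.sym (∣⁅x⁆∣≡1 ω)) ∣⁅ω⁆∣≡2

ℋ-ground : ∀ {ω : Fin n} → (∀ (x y : Fin n) → ∃ λ z → z ≢ x × z ≢ y) → HasGroundSet (ℋ ω) ⊤
ℋ-ground {ω = ω} avoid x = mk⇔ covered (λ _ → ∈⊤)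
  where
  covered : x ∈ ⊤ → ∃ λ A → ℋ ω A × x ∈ A
  covered _ with x ≟ ω
  ... | yes refl = ⁅ ω ⁆ , inj₁ refl , x∈⁅x⁆ ω
  ... | no x≢ω with z , z≢x , z≢ω ← avoid x ω =
    doubleton x z , inj₂ (doubleton⊆ (x≢y⇒x∈⊤-y x≢ω) (x≢y⇒x∈⊤-y z≢ω) , ∣doubleton∣≡2 (z≢x ∘ ≡.sym)) ,
    a∈doubleton

𝒰⩽ℋ : ∀ {ω : Fin n} → 𝒰 2 ⊤ ⩽ ℋ ω
𝒰⩽ℋ {ω = ω} A (_ , ∣A∣≡2) with ω ∈? A
... | yes ω∈A = ⁅ ω ⁆ , inj₁ refl , x∈p⇒⁅x⁆⊆p ω∈A
... | no ω∉A  = A , inj₂ (x∉p⇒p⊆⊤-x ω∉A , ∣A∣≡2) , λ x∈A → x∈A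

-- A completion below ℋ ω contains ⁅ ω ⁆ and every pair avoiding ω.
DomCompletion⩽ℋ⇒≈ : ∀ {H : Family n} {ω} → ¬ 2 ∣ n → (∀ v → ∃ λ w → w ≢ v) →
                    IsDomCompletion 2 H → H ⩽ ℋ ω → H ≈ ℋ ω
DomCompletion⩽ℋ⇒≈ {H = H} {ω} ¬2∣n other completion@(domH , _ , 𝒰⩽H) H⩽ℋ =
  Antichain∧⊇∧⩽⇒≈ (IsDominationHypergraph⇒Antichain domH) ℋ⊆H H⩽ℋ
  where
  H⁅ω⁆ : H ⁅ ω ⁆
  H⁅ω⁆ with ω′ , H⁅ω′⁆ ← DomCompletion⇒singleton ¬2∣n other completion
    with H⩽ℋ ⁅ ω′ ⁆ H⁅ω′⁆
  ... | _ , inj₁ refl , ⁅ω⁆⊆⁅ω′⁆ = subst (H ∘ ⁅_⁆) (≡.sym (x∈⁅y⁆⇒x≡y ω′ (⁅ω⁆⊆⁅ω′⁆ (x∈⁅x⁆ ω)))) H⁅ω′⁆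
  ... | B , inj₂ (_ , ∣B∣≡2) , B⊆⁅ω′⁆ =
    contradiction (subst₂ _≤_ ∣B∣≡2 (∣⁅x⁆∣≡1 ω′) (p⊆q⇒∣p∣≤∣q∣ B⊆⁅ω′⁆)) λ { (s≤s ()) }

  ℋ⊆H : ∀ A → ℋ ω A → H A
  ℋ⊆H A (inj₁ refl) = H⁅ω⁆
  ℋ⊆H A (inj₂ (A⊆ , ∣A∣≡2)) with C , HC , C⊆A ← 𝒰⩽H A (⊆⊤ , ∣A∣≡2) with H⩽ℋ C HC
  ... | D , inj₁ refl , ⁅ω⁆⊆C = contradiction refl (x∈p-y⇒x≢y (A⊆ (C⊆A (⁅ω⁆⊆C (x∈⁅x⁆ ω)))))
  ... | D , inj₂ 𝒰D , D⊆C with D≡A ← 𝒰-Antichain (A⊆ , ∣A∣≡2) 𝒰D (⊆-trans D⊆C C⊆A) =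
    subst H (⊆-antisym C⊆A (subst (_⊆ C) D≡A D⊆C)) HC

-- Decompositions

Unions : ∀ {t} → (Fin t → Family n) → Family n
Unions {t = t} Hs A = ∃ λ (as : Fin t → Subset _) → (∀ i → Hs i (as i)) × A ≡ ⋃ᶠ as

Unions-pair⁺ : ∀ {H₁ H₂ : Family n} {X Y} → H₁ X → H₂ Y → Unions (pair H₁ H₂) (X ∪ Y)
Unions-pair⁺ {X = X} {Y} H₁X H₂Y = as , members , cong (X ∪_) (≡.sym (∪-identityʳ Y))
  where
  as : Fin 2 → Subset _
  as zero       = X
  as (suc zero) = Y
  members : ∀ i → pair _ _ i (as i)
  members zero       = H₁X
  members (suc zero) = H₂Y

Unions-pair⁻ : ∀ {H₁ H₂ : Family n} → Unions (pair H₁ H₂) A → ∃₂ λ X Y → H₁ X × H₂ Y × A ≡ X ∪ Y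
Unions-pair⁻ (as , members , A≡) =
  as zero , as (suc zero) , members zero , members (suc zero) , trans A≡ (cong (as zero ∪_) (∪-identityʳ _))

ℋ-member⊆doubleton : ∀ {ω : Fin n} → ℋ ω B → B ⊆ doubleton a b → a ≢ b → B ≡ ⁅ ω ⁆ ⊎ B ≡ doubleton a b
ℋ-member⊆doubleton (inj₁ B≡⁅ω⁆) _ _ = inj₁ B≡⁅ω⁆
ℋ-member⊆doubleton (inj₂ (_ , ∣B∣≡2)) B⊆ab a≢b = inj₂ (𝒰-Antichain (⊆⊤ , ∣doubleton∣≡2 a≢b) (⊆⊤ , ∣B∣≡2) B⊆ab)

module _ {ω₁ ω₂ : Fin n} (ω₁≢ω₂ : ω₁ ≢ ω₂) where

  ∣doubleton∣≤∣X∪Y∣ : ∀ {X Y} → ℋ ω₁ X → ℋ ω₂ Y → X ⊆ doubleton a b → Y ⊆ doubleton a b → a ≢ b →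
                      ∣ doubleton a b ∣ ≤ ∣ X ∪ Y ∣
  ∣doubleton∣≤∣X∪Y∣ {X = X} {Y} ℋX ℋY X⊆ab Y⊆ab a≢b
    with ℋ-member⊆doubleton ℋX X⊆ab a≢b | ℋ-member⊆doubleton ℋY Y⊆ab a≢b
  ... | inj₂ refl | _         = ∣p∣≤∣p∪q∣ X Y
  ... | _         | inj₂ refl = ∣q∣≤∣p∪q∣ X Y
  ... | inj₁ refl | inj₁ refl = ≤-reflexive (trans (∣doubleton∣≡2 a≢b) (≡.sym (∣doubleton∣≡2 ω₁≢ω₂)))

  doubleton∈Unions : a ≢ b → Unions (pair (ℋ ω₁) (ℋ ω₂)) (doubleton a b)
  doubleton∈Unions {a} {b} a≢b
    with X , ℋX , X⊆ab ← 𝒰⩽ℋ {ω = ω₁} (doubleton a b) (⊆⊤ , ∣doubleton∣≡2 a≢b)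
    with Y , ℋY , Y⊆ab ← 𝒰⩽ℋ {ω = ω₂} (doubleton a b) (⊆⊤ , ∣doubleton∣≡2 a≢b) =
    subst (Unions (pair (ℋ ω₁) (ℋ ω₂)))
          (⊆∧∣∣≤⇒≡ X∪Y⊆ab (∣doubleton∣≤∣X∪Y∣ ℋX ℋY X⊆ab Y⊆ab a≢b))
          (Unions-pair⁺ ℋX ℋY)
    where
    X∪Y⊆ab : X ∪ Y ⊆ doubleton a b
    X∪Y⊆ab x∈X∪Y with x∈p∪q⁻ X Y x∈X∪Y
    ... | inj₁ x∈X = X⊆ab x∈X
    ... | inj₂ x∈Y = Y⊆ab x∈Y

  Unions⩽𝒰 : Unions (pair (ℋ ω₁) (ℋ ω₂)) ⩽ 𝒰 2 ⊤
  Unions⩽𝒰 A unions with X , Y , ℋX , ℋY , refl ← Unions-pair⁻ unions with ℋX | ℋY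
  ... | inj₂ (_ , ∣X∣≡2) | _ = X , (⊆⊤ , ∣X∣≡2) , p⊆p∪q Y
  ... | _ | inj₂ (_ , ∣Y∣≡2) = Y , (⊆⊤ , ∣Y∣≡2) , q⊆p∪q X Y
  ... | inj₁ refl | inj₁ refl = X ∪ Y , (⊆⊤ , ∣doubleton∣≡2 ω₁≢ω₂) , λ x∈ → x∈

  𝒰≈Meet-ℋ : 𝒰 2 ⊤ ≈ Meet (pair (ℋ ω₁) (ℋ ω₂))
  𝒰≈Meet-ℋ = ≈-sym (Minimal≈Antichain 𝒰-Antichain 𝒰⊆Unions Unions⩽𝒰)
    where
    𝒰⊆Unions : ∀ A → 𝒰 2 ⊤ A → Unions (pair (ℋ ω₁) (ℋ ω₂)) A
    𝒰⊆Unions A (_ , ∣A∣≡2) with a , b , a≢b , A≡ab ← ∣p∣≡2⇒p≡doubleton ∣A∣≡2 =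
      subst (Unions (pair (ℋ ω₁) (ℋ ω₂))) (≡.sym A≡ab) (doubleton∈Unions a≢b)

module _ (odd : n % 2 ≡ 1) (avoid : ∀ (x y : Fin n) → ∃ λ z → z ≢ x × z ≢ y) where

  private
    other : ∀ v → ∃ λ w → w ≢ v
    other v with w , w≢v , _ ← avoid v v = w , w≢v

  ℋ-IsDomCompletion : ∀ ω → IsDomCompletion 2 (ℋ ω)
  ℋ-IsDomCompletion ω with w , w≢ω ← other ω =
    ℋ-IsDominationHypergraph (odd⇒nearPerfectMatching odd ω) w≢ω , ℋ-ground avoid , 𝒰⩽ℋ

  IsMinDomCompletion⇔≈ℋ : ∀ (H : Family n) → IsMinDomCompletion 2 H ⇔ (∃ λ ω → H ≈ ℋ ω)
  IsMinDomCompletion⇔≈ℋ H = mk⇔ minimal⇒≈ℋ ≈ℋ⇒minimal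
    where
    minimal⇒≈ℋ : IsMinDomCompletion 2 H → ∃ λ ω → H ≈ ℋ ω
    minimal⇒≈ℋ (completion@(_ , _ , 𝒰⩽H) , minimal)
      with ω , H⁅ω⁆ ← DomCompletion⇒singleton (odd⇒¬2∣n odd) other completion =
      ω , ≈-sym (minimal (ℋ ω) (ℋ-IsDomCompletion ω) ℋ⩽H)
      where
      ℋ⩽H : ℋ ω ⩽ H
      ℋ⩽H A (inj₁ refl)          = ⁅ ω ⁆ , H⁅ω⁆ , λ x∈⁅ω⁆ → x∈⁅ω⁆
      ℋ⩽H A (inj₂ (_ , ∣A∣≡2)) = 𝒰⩽H A (⊆⊤ , ∣A∣≡2)
    ≈ℋ⇒minimal : (∃ λ ω → H ≈ ℋ ω) → IsMinDomCompletion 2 H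
    ≈ℋ⇒minimal (ω , H≈ℋ) =
      IsDomCompletion-resp-≈ (≈-sym H≈ℋ) (ℋ-IsDomCompletion ω) ,
      λ H′ completion H′⩽H →
        ≈-trans (DomCompletion⩽ℋ⇒≈ (odd⇒¬2∣n odd) other completion (⩽-respʳ-≈ H≈ℋ H′⩽H)) (≈-sym H≈ℋ)

  IsDecomposition-ℋ : ∀ {ω₁ ω₂} → ω₁ ≢ ω₂ → IsDecomposition 2 2 (pair (ℋ ω₁) (ℋ ω₂))
  IsDecomposition-ℋ {ω₁} {ω₂} ω₁≢ω₂ = distinct , members , ≈-sym (𝒰≈Meet-ℋ ω₁≢ω₂)
    where
    distinct : ∀ i j → i ≢ j → ¬ (pair (ℋ ω₁) (ℋ ω₂) i ≈ pair (ℋ ω₁) (ℋ ω₂) j)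
    distinct zero       zero       i≢i _ = i≢i refl
    distinct zero       (suc zero) _   ℋ₁≈ℋ₂ = ω₁≢ω₂ (ℋ-injective ℋ₁≈ℋ₂)
    distinct (suc zero) zero       _   ℋ₂≈ℋ₁ = ω₁≢ω₂ (≡.sym (ℋ-injective ℋ₂≈ℋ₁))
    distinct (suc zero) (suc zero) i≢i _ = i≢i refl
    members : ∀ i → IsDominationHypergraph (pair (ℋ ω₁) (ℋ ω₂) i) × HasGroundSet (pair (ℋ ω₁) (ℋ ω₂) i) ⊤
    members zero       = proj₁ (ℋ-IsDomCompletion ω₁) , proj₁ (proj₂ (ℋ-IsDomCompletion ω₁))
    members (suc zero) = proj₁ (ℋ-IsDomCompletion ω₂) , proj₁ (proj₂ (ℋ-IsDomCompletion ω₂))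

  -- A single domination hypergraph would have every pair as a minimal dominating set.
  ¬HasDecomposition : ∀ s → s < 2 → ¬ HasDecomposition n 2 s
  ¬HasDecomposition zero _ (Hs , _ , _ , Meet≈𝒰) =
    contradiction (trans (≡.sym (∣⊥∣≡0 n)) (proj₂ (to (Meet≈𝒰 ⊥) ⊥∈Meet))) λ ()
    where
    ⊥∈Meet : Meet Hs ⊥
    ⊥∈Meet = ((λ ()) , (λ ()) , refl) , λ { _ (_ , _ , B≡⊥) _ → B≡⊥ }
  ¬HasDecomposition (suc zero) _ (Hs , _ , members , Meet≈𝒰) =
    odd⇒¬2∣n odd (doubletons∈𝒟⇒2∣n G other doubletons)
    where
    G = proj₁ (proj₁ (members zero))
    doubletons : ∀ a b → a ≢ b → 𝒟 G (doubleton a b)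
    doubletons a b a≢b
      with as , member , ab≡ ← proj₁ (from (Meet≈𝒰 (doubleton a b)) (⊆⊤ , ∣doubleton∣≡2 a≢b)) =
      from (proj₂ (proj₁ (members zero)) (doubleton a b))
        (subst (Hs zero) (≡.sym (trans ab≡ (∪-identityʳ (as zero)))) (member zero))
  ¬HasDecomposition (suc (suc _)) (s≤s (s≤s ()))

  𝔇≡2 : 𝔇≡ n 2 2
  𝔇≡2 with x ← subst Fin (≡.sym (odd⇒≡1+[n/2]*2 odd)) zero with y , y≢x ← other x =
    (pair (ℋ x) (ℋ y) , IsDecomposition-ℋ (y≢x ∘ ≡.sym)) , ¬HasDecomposition

theorem4p2 : (n : ℕ) → 3 ≤ n → n % 2 ≡ 1 →
    (∀ (ω : Fin n) →
      IsDominationHypergraph (ℋ ω) ×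
      (∀ (G : Graph n) → V G ≡ ⊤ →
        (𝒟 G ≈ ℋ ω ⇔
          (Σ (Graph n) λ G' → (V G' ≡ ⊤ - ω) × (𝒟 G' ≈ 𝒰 2 (⊤ - ω)) × IsJoin G (K ⁅ ω ⁆) G')))) ×
    ((∀ (H : Family n) → IsMinDomCompletion 2 H ⇔ (∃ λ (ω : Fin n) → H ≈ ℋ ω)) ×
     (∀ (ω ω' : Fin n) → ω ≢ ω' → ¬ (ℋ ω ≈ ℋ ω'))) ×
    ((∀ (ω₁ ω₂ : Fin n) → ω₁ ≢ ω₂ →
        (𝒰 2 ⊤ ≈ Meet (pair (ℋ ω₁) (ℋ ω₂))) × IsDecomposition 2 2 (pair (ℋ ω₁) (ℋ ω₂))) ×
     𝔇≡ n 2 2)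
theorem4p2 (suc (suc (suc _))) (s≤s (s≤s (s≤s _))) odd =
  (λ ω → proj₁ (ℋ-IsDomCompletion odd avoid₂ ω) , λ G V≡⊤ → 𝒟≈ℋ⇔IsJoin {G = G} (punchInᵢ≢i ω zero) V≡⊤) ,
  (IsMinDomCompletion⇔≈ℋ odd avoid₂ , λ ω ω′ ω≢ω′ → ω≢ω′ ∘ ℋ-injective) ,
  ((λ ω₁ ω₂ ω₁≢ω₂ → 𝒰≈Meet-ℋ ω₁≢ω₂ , IsDecomposition-ℋ odd avoid₂ ω₁≢ω₂) , 𝔇≡2 odd avoid₂)
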